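{- Let $\lambda$ be a nonzero real number, let $n\ge 0$ be an integer, and let $m\in\mathbb{N}$ with $m\equiv 1 \pmod 2$. Then $$\mathcal{E}_{n,\lambda}+\mathcal{E}_{n,\lambda}(m)=2\sum_{k=0}^{n}\sum_{l=0}^{m-1}(-1)^l\, S_{1,\lambda}(n,k)\, l^k ,$$ with the convention $0^0=1$.
   Context: For $\lambda\neq 0$ the degenerate falling factorials are $(x)_{0,\lambda}=1$ and $(x)_{n,\lambda}=x(x-\lambda)(x-2\lambda)\cdots(x-(n-1)\lambda)$ for $n\ge1$. The degenerate Stirling numbers of the first kind $S_{1,\lambda}(n,k)$ are defined by $(x)_{n,\lambda}=\sum_{k=0}^n S_{1,\lambda}(n,k)x^k$ for $n\ge 0$. The degenerate Euler polynomials $\mathcal{E}_{n,\lambda}(x)$ are defined by the generating function $\frac{2}{(1+\lambda t)^{1/\lambda}+1}(1+\lambda t)^{x/\lambda}=\sum_{n=0}^\infty \mathcal{E}_{n,\lambda}(x)\frac{t^n}{n!}$, and the degenerate Euler numbers are $\mathcal{E}_{n,\lambda}=\mathcal{E}_{n,\lambda}(0)$. -}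

module Defs where

open import Level using (_⊔_)
open import Algebra.Bundles using (CommutativeRing)
open import Data.Nat using (ℕ; zero; suc; _∸_)
open import Data.Nat.Combinatorics using (_C_)

-- All notions are defined over an arbitrary commutative ring R
-- (the paper works over the reals, which is one instance).
module Degenerate {c ℓ} (R : CommutativeRing c ℓ) where
  open CommutativeRing R

  fromℕ : ℕ → Carrier
  fromℕ zero = 0#
  fromℕ (suc n) = 1# + fromℕ n

  -- x ^ n with x ^ 0 = 1 (so 0 ^ 0 = 1)
  pow : Carrier → ℕ → Carrier
  pow x zero = 1#
  pow x (suc n) = x * pow x n

  Σ< : ℕ → (ℕ → Carrier) → Carrier
  Σ< zero f = 0#
  Σ< (suc n) f = Σ< n f + f n

  Σ≤ : ℕ → (ℕ → Carrier) → Carrier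
  Σ≤ n f = Σ< (suc n) f

  fallλ : Carrier → Carrier → ℕ → Carrier
  fallλ lam x zero = 1#
  fallλ lam x (suc n) = fallλ lam x n * (x - fromℕ n * lam)

  shift : (ℕ → Carrier) → ℕ → Carrier
  shift p zero = 0#
  shift p (suc k) = p k

  -- coefficients of the polynomial (x)_{n,λ} = x (x-λ) ... (x-(n-1)λ),
  -- computed as the iterated product of the linear factors (x - jλ)
  fallCoeff : Carrier → ℕ → ℕ → Carrier
  fallCoeff lam zero zero = 1#
  fallCoeff lam zero (suc k) = 0#
  fallCoeff lam (suc n) k = shift (fallCoeff lam n) k - (fromℕ n * lam) * fallCoeff lam n k

  -- degenerate Stirling numbers of the first kind:
  -- (x)_{n,λ} = Σ_{k=0}^n S1λ λ n k x^k
  S1λ : Carrier → ℕ → ℕ → Carrier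
  S1λ lam n k = fallCoeff lam n k

  δ0 : ℕ → Carrier
  δ0 zero = 1#
  δ0 (suc _) = 0#

  -- E is the family of degenerate Euler polynomials E x n = 𝓔_{n,λ}(x), i.e.
  --   2/((1+λt)^{1/λ}+1) (1+λt)^{x/λ} = Σ_n E x n t^n/n!,
  -- written coefficientwise (using (1+λt)^{x/λ} = Σ_n (x)_{n,λ} t^n/n!) as
  --   (Σ_n E x n t^n/n!) ((1+λt)^{1/λ} + 1) = 2 (1+λt)^{x/λ}.
  IsDegEuler : Carrier → (Carrier → ℕ → Carrier) → Set (c ⊔ ℓ)
  IsDegEuler lam E = ∀ x n →
    Σ≤ n (λ k → fromℕ (n C k) * E x k * (fallλ lam 1# (n ∸ k) + δ0 (n ∸ k)))
      ≈ (1# + 1#) * fallλ lam x n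

module Submission where

-- Write (w ⋆ a)(n) = Σ_k C(n,k) a(k) w(n-k) for the binomial convolution
-- (product of exponential generating functions).  The defining relation of the
-- degenerate Euler polynomials says  κ ⋆ E(x) = 2 (x)_{·,λ}  with the kernel
-- κ(j) = (1)_{j,λ} + δ_{j,0}.  By the degenerate Vandermonde identity
-- (1)_{·,λ} ⋆ (x)_{·,λ} = (x+1)_{·,λ}, the sequence E(x+1) + E(x) satisfies the
-- same relation as 2 (x)_{·,λ}; since κ(0) = 2 is invertible, convolution with κ
-- is injective, which yields the functional equation
--     𝓔_{n,λ}(x) + 𝓔_{n,λ}(x+1) = 2 (x)_{n,λ}.
-- For odd m the alternating sum Σ_{l<m} (-1)^l (Q(l) + Q(l+1)) telescopes to
-- Q(0) + Q(m); with Q(l) = 𝓔_{n,λ}(l) and (l)_{n,λ} = Σ_k S_{1,λ}(n,k) l^k this is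
-- the theorem.  (The hypothesis λ ≠ 0 is not needed in this coefficientwise
-- formulation of the generating function.)

open import Algebra.Bundles using (CommutativeRing; RawRing)
open import Algebra.Solver.Ring.AlmostCommutativeRing
  using (fromCommutativeRing; _-Raw-AlmostCommutative⟶_)
open import Data.Maybe using (Maybe; just; nothing)
open import Data.Nat as ℕ using (ℕ; zero; suc; _∸_; _<_; _%_; s≤s)
import Data.Nat.Properties as ℕₚ
open import Data.Nat.Combinatorics using (_C_; nCn≡1; nCk+nC[k+1]≡[n+1]C[k+1]; k>n⇒nCk≡0)
open import Data.Nat.DivMod using (_/_; m≡m%n+[m/n]*n)
open import Data.Nat.Induction using (<-rec)
open import Data.Product using (_×_; _,_)
open import Data.Product.Properties using (≡-dec)
open import Relation.Binary.PropositionalEquality as ≡ using (_≡_)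
open import Relation.Nullary using (¬_; yes; no)
open import Defs

module DegenerateEulerTheory {c ℓ} (R : CommutativeRing c ℓ) where
  open CommutativeRing R
  open Degenerate R
  open import Relation.Binary.Reasoning.Setoid setoid
  open import Algebra.Properties.Ring ring using (-1*x≈-x; [y-z]x≈yx-zx)
  open import Algebra.Properties.AbelianGroup +-abelianGroup
    using (⁻¹-∙-comm; ⁻¹-anti-homo‿-; ε⁻¹≈ε; ⁻¹-involutive; x∙y⁻¹≈ε⇒x≈y)
  open import Algebra.Properties.Semiring.Mult semiring
    using (×-homo-+; ×1-homo-*) renaming (_×_ to _·_)
  import Algebra.Solver.CommutativeMonoid +-commutativeMonoid as +-Solver

  two : Carrier
  two = 1# + 1#

  fromℕ≡·1 : ∀ n → fromℕ n ≡ n · 1#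
  fromℕ≡·1 zero = ≡.refl
  fromℕ≡·1 (suc n) = ≡.cong (1# +_) (fromℕ≡·1 n)

  fromℕ-+ : ∀ a b → fromℕ (a ℕ.+ b) ≈ fromℕ a + fromℕ b
  fromℕ-+ a b rewrite fromℕ≡·1 (a ℕ.+ b) | fromℕ≡·1 a | fromℕ≡·1 b = ×-homo-+ 1# a b

  fromℕ-* : ∀ a b → fromℕ (a ℕ.* b) ≈ fromℕ a * fromℕ b
  fromℕ-* a b rewrite fromℕ≡·1 (a ℕ.* b) | fromℕ≡·1 a | fromℕ≡·1 b = ×1-homo-* a b

  -- An integer is a pair (a , b)
  -- read as a - b and kept normalised (one component is zero), so that
  -- coefficient equality is decided syntactically; this lets the solver
  -- prove identities that rely on cancellation, such as (p - q) + q = p.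
  module IntegerSolver where
    normalise : ℕ → ℕ → ℕ × ℕ
    normalise a b = (a ∸ b , b ∸ a)

    Integers : RawRing _ _
    Integers = record
      { Carrier = ℕ × ℕ ; _≈_ = _≡_
      ; _+_ = λ { (a , b) (c , d) → normalise (a ℕ.+ c) (b ℕ.+ d) }
      ; _*_ = λ { (a , b) (c , d) → normalise (a ℕ.* c ℕ.+ b ℕ.* d) (a ℕ.* d ℕ.+ b ℕ.* c) }
      ; -_ = λ { (a , b) → (b , a) }
      ; 0# = (0 , 0) ; 1# = (1 , 0) }

    ⟦_⟧ℤ : ℕ × ℕ → Carrier
    ⟦ (a , b) ⟧ℤ = fromℕ a - fromℕ b

    difference-+ : ∀ p q r s → (p - q) + (r - s) ≈ (p + r) - (q + s)
    difference-+ p q r s = begin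
      (p - q) + (r - s)     ≈⟨ +-Solver.solve 4 (λ p q r s → (p ⊕ q) ⊕ (r ⊕ s) ⊜ (p ⊕ r) ⊕ (q ⊕ s)) refl p (- q) r (- s) ⟩
      (p + r) + (- q + - s) ≈⟨ +-congˡ (⁻¹-∙-comm q s) ⟩
      (p + r) - (q + s)     ∎
      where open +-Solver using (_⊕_; _⊜_)

    difference-* : ∀ p q r s → (p - q) * (r - s) ≈ (p * r + q * s) - (p * s + q * r)
    difference-* p q r s = begin
      (p - q) * (r - s)                     ≈⟨ [y-z]x≈yx-zx (r - s) p q ⟩
      p * (r - s) - q * (r - s)             ≈⟨ +-cong (*-comm p _) (-‿cong (*-comm q _)) ⟩
      (r - s) * p - (r - s) * q             ≈⟨ +-cong ([y-z]x≈yx-zx p r s) (-‿cong ([y-z]x≈yx-zx q r s)) ⟩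
      (r * p - s * p) - (r * q - s * q)     ≈⟨ +-congˡ (⁻¹-anti-homo‿- _ _) ⟩
      (r * p - s * p) + (s * q - r * q)     ≈⟨ +-cong (+-cong (*-comm r p) (-‿cong (*-comm s p))) (+-cong (*-comm s q) (-‿cong (*-comm r q))) ⟩
      (p * r - p * s) + (q * s - q * r)     ≈⟨ difference-+ _ _ _ _ ⟩
      (p * r + q * s) - (p * s + q * r)     ∎

    ⟦normalise⟧ : ∀ a b → ⟦ normalise a b ⟧ℤ ≈ fromℕ a - fromℕ b
    ⟦normalise⟧ zero zero = refl
    ⟦normalise⟧ zero (suc b) = refl
    ⟦normalise⟧ (suc a) zero = refl
    ⟦normalise⟧ (suc a) (suc b) = begin
      ⟦ normalise a b ⟧ℤ                      ≈⟨ ⟦normalise⟧ a b ⟩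
      fromℕ a - fromℕ b                       ≈⟨ sym (+-identityˡ _) ⟩
      0# + (fromℕ a - fromℕ b)                ≈⟨ +-congʳ (sym (-‿inverseʳ 1#)) ⟩
      (1# - 1#) + (fromℕ a - fromℕ b)         ≈⟨ difference-+ _ _ _ _ ⟩
      fromℕ (suc a) - fromℕ (suc b)           ∎

    embedding : Integers -Raw-AlmostCommutative⟶ fromCommutativeRing R
    embedding = record
      { ⟦_⟧ = ⟦_⟧ℤ
      ; +-homo = λ { (a , b) (c , d) → begin
          ⟦ normalise (a ℕ.+ c) (b ℕ.+ d) ⟧ℤ        ≈⟨ ⟦normalise⟧ (a ℕ.+ c) (b ℕ.+ d) ⟩
          fromℕ (a ℕ.+ c) - fromℕ (b ℕ.+ d)         ≈⟨ +-cong (fromℕ-+ a c) (-‿cong (fromℕ-+ b d)) ⟩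
          (fromℕ a + fromℕ c) - (fromℕ b + fromℕ d) ≈⟨ sym (difference-+ _ _ _ _) ⟩
          ⟦ (a , b) ⟧ℤ + ⟦ (c , d) ⟧ℤ               ∎ }
      ; *-homo = λ { (a , b) (c , d) → begin
          ⟦ normalise (a ℕ.* c ℕ.+ b ℕ.* d) (a ℕ.* d ℕ.+ b ℕ.* c) ⟧ℤ ≈⟨ ⟦normalise⟧ (a ℕ.* c ℕ.+ b ℕ.* d) (a ℕ.* d ℕ.+ b ℕ.* c) ⟩
          fromℕ (a ℕ.* c ℕ.+ b ℕ.* d) - fromℕ (a ℕ.* d ℕ.+ b ℕ.* c)
            ≈⟨ +-cong (trans (fromℕ-+ (a ℕ.* c) (b ℕ.* d)) (+-cong (fromℕ-* a c) (fromℕ-* b d)))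
                      (-‿cong (trans (fromℕ-+ (a ℕ.* d) (b ℕ.* c)) (+-cong (fromℕ-* a d) (fromℕ-* b c)))) ⟩
          (fromℕ a * fromℕ c + fromℕ b * fromℕ d) - (fromℕ a * fromℕ d + fromℕ b * fromℕ c)
            ≈⟨ sym (difference-* _ _ _ _) ⟩
          ⟦ (a , b) ⟧ℤ * ⟦ (c , d) ⟧ℤ ∎ }
      ; -‿homo = λ { (a , b) → sym (⁻¹-anti-homo‿- _ _) }
      ; 0-homo = -‿inverseʳ 0#
      ; 1-homo = trans (+-congˡ ε⁻¹≈ε) (trans (+-identityʳ _) (+-identityʳ _))
      }

    decide : ∀ x y → Maybe (⟦ x ⟧ℤ ≈ ⟦ y ⟧ℤ)
    decide x y with ≡-dec ℕₚ._≟_ ℕₚ._≟_ x y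
    ... | yes ≡.refl = just refl
    ... | no _ = nothing

    open import Algebra.Solver.Ring Integers (fromCommutativeRing R) embedding decide public
      using (solve; _:=_; _:+_; _:*_; _:-_; :-_)

  open IntegerSolver using (solve; _:=_; _:+_; _:*_; _:-_; :-_)

  Σ-cong : ∀ n {f g : ℕ → Carrier} → (∀ i → i < n → f i ≈ g i) → Σ< n f ≈ Σ< n g
  Σ-cong zero eq = refl
  Σ-cong (suc n) eq = +-cong (Σ-cong n (λ i i<n → eq i (ℕₚ.m<n⇒m<1+n i<n))) (eq n ℕₚ.≤-refl)

  Σ-cong′ : ∀ n {f g : ℕ → Carrier} → (∀ i → f i ≈ g i) → Σ< n f ≈ Σ< n g
  Σ-cong′ n eq = Σ-cong n (λ i _ → eq i)

  Σ-+ : ∀ n (f g : ℕ → Carrier) → Σ< n (λ i → f i + g i) ≈ Σ< n f + Σ< n g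
  Σ-+ zero f g = sym (+-identityʳ 0#)
  Σ-+ (suc n) f g = trans (+-congʳ (Σ-+ n f g)) (solve 4 (λ a b c d → (a :+ b) :+ (c :+ d) := (a :+ c) :+ (b :+ d)) refl _ _ _ _)

  Σ-*ˡ : ∀ n t (f : ℕ → Carrier) → t * Σ< n f ≈ Σ< n (λ i → t * f i)
  Σ-*ˡ zero t f = zeroʳ t
  Σ-*ˡ (suc n) t f = trans (distribˡ t _ _) (+-congʳ (Σ-*ˡ n t f))

  Σ-zero : ∀ n (f : ℕ → Carrier) → (∀ i → i < n → f i ≈ 0#) → Σ< n f ≈ 0#
  Σ-zero zero f vanish = refl
  Σ-zero (suc n) f vanish =
    trans (+-cong (Σ-zero n f (λ i i<n → vanish i (ℕₚ.m<n⇒m<1+n i<n))) (vanish n ℕₚ.≤-refl)) (+-identityʳ 0#)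

  Σ-front : ∀ n (f : ℕ → Carrier) → Σ< (suc n) f ≈ f 0 + Σ< n (λ i → f (suc i))
  Σ-front zero f = trans (+-identityˡ _) (sym (+-identityʳ _))
  Σ-front (suc n) f = trans (+-congʳ (Σ-front n f)) (+-assoc _ _ _)

  Σ-swap : ∀ n m (f : ℕ → ℕ → Carrier) →
    Σ< n (λ i → Σ< m (λ j → f i j)) ≈ Σ< m (λ j → Σ< n (λ i → f i j))
  Σ-swap zero m f = sym (Σ-zero m _ (λ _ _ → refl))
  Σ-swap (suc n) m f = trans (+-congʳ (Σ-swap n m f)) (sym (Σ-+ m _ _))

  Σ-factor-swap : ∀ m n t (s a : ℕ → Carrier) (b : ℕ → ℕ → Carrier) →
    Σ< m (λ l → s l * (t * Σ< n (λ k → a k * b l k)))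
      ≈ t * Σ< n (λ k → Σ< m (λ l → s l * a k * b l k))
  Σ-factor-swap m n t s a b = begin
    Σ< m (λ l → s l * (t * Σ< n (λ k → a k * b l k)))
      ≈⟨ Σ-cong′ m (λ l → solve 3 (λ s t Σ → s :* (t :* Σ) := t :* (s :* Σ)) refl _ _ _) ⟩
    Σ< m (λ l → t * (s l * Σ< n (λ k → a k * b l k)))
      ≈⟨ sym (Σ-*ˡ m t _) ⟩
    t * Σ< m (λ l → s l * Σ< n (λ k → a k * b l k))
      ≈⟨ *-congˡ (Σ-cong′ m (λ l → trans (Σ-*ˡ n (s l) _) (Σ-cong′ n (λ k → sym (*-assoc _ _ _))))) ⟩
    t * Σ< m (λ l → Σ< n (λ k → s l * a k * b l k))
      ≈⟨ *-congˡ (Σ-swap m n _) ⟩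
    t * Σ< n (λ k → Σ< m (λ l → s l * a k * b l k)) ∎

  evalPoly : ℕ → (ℕ → Carrier) → Carrier → Carrier
  evalPoly n c x = Σ≤ n (λ k → c k * pow x k)

  evalPoly-shift : ∀ n c x → evalPoly (suc n) (shift c) x ≈ x * evalPoly n c x
  evalPoly-shift n c x = begin
    evalPoly (suc n) (shift c) x                  ≈⟨ Σ-front (suc n) _ ⟩
    0# * 1# + Σ≤ n (λ i → c i * (x * pow x i))
      ≈⟨ +-cong (zeroˡ 1#) (Σ-cong′ (suc n) (λ i → solve 3 (λ c x p → c :* (x :* p) := x :* (c :* p)) refl _ _ _)) ⟩
    0# + Σ≤ n (λ i → x * (c i * pow x i))         ≈⟨ +-identityˡ _ ⟩
    Σ≤ n (λ i → x * (c i * pow x i))              ≈⟨ sym (Σ-*ˡ (suc n) x _) ⟩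
    x * evalPoly n c x                            ∎

  evalPoly-top : ∀ n c x → c (suc n) ≈ 0# → evalPoly (suc n) c x ≈ evalPoly n c x
  evalPoly-top n c x top≈0 =
    trans (+-congˡ (trans (*-congʳ top≈0) (zeroˡ _))) (+-identityʳ _)

  evalPoly-linear : ∀ n c a x → c (suc n) ≈ 0# →
    evalPoly (suc n) (λ k → shift c k - a * c k) x ≈ evalPoly n c x * (x - a)
  evalPoly-linear n c a x top≈0 = begin
    evalPoly (suc n) (λ k → shift c k - a * c k) x
      ≈⟨ Σ-cong′ (suc (suc n)) (λ k → solve 4 (λ s a c p → (s :- a :* c) :* p := s :* p :+ (:- a) :* (c :* p)) refl _ _ _ _) ⟩
    Σ≤ (suc n) (λ k → shift c k * pow x k + - a * (c k * pow x k))
      ≈⟨ Σ-+ (suc (suc n)) _ _ ⟩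
    evalPoly (suc n) (shift c) x + Σ≤ (suc n) (λ k → - a * (c k * pow x k))
      ≈⟨ +-cong (evalPoly-shift n c x) (sym (Σ-*ˡ (suc (suc n)) (- a) _)) ⟩
    x * evalPoly n c x + - a * evalPoly (suc n) c x
      ≈⟨ +-congˡ (*-congˡ (evalPoly-top n c x top≈0)) ⟩
    x * evalPoly n c x + - a * evalPoly n c x
      ≈⟨ solve 3 (λ x a P → x :* P :+ (:- a) :* P := P :* (x :- a)) refl _ _ _ ⟩
    evalPoly n c x * (x - a) ∎

  fallCoeff-vanish : ∀ lam n k → n < k → fallCoeff lam n k ≈ 0#
  fallCoeff-vanish lam zero (suc k) _ = refl
  fallCoeff-vanish lam (suc n) (suc k) (s≤s n<k) = begin
    fallCoeff lam n k - fromℕ n * lam * fallCoeff lam n (suc k)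
      ≈⟨ +-cong (fallCoeff-vanish lam n k n<k) (-‿cong (*-congˡ (fallCoeff-vanish lam n (suc k) (ℕₚ.m<n⇒m<1+n n<k)))) ⟩
    0# - fromℕ n * lam * 0#
      ≈⟨ trans (+-congˡ (-‿cong (zeroʳ _))) (-‿inverseʳ 0#) ⟩
    0# ∎

  fallλ-expansion : ∀ lam x n → fallλ lam x n ≈ evalPoly n (S1λ lam n) x
  fallλ-expansion lam x zero = sym (trans (+-identityˡ _) (*-identityʳ _))
  fallλ-expansion lam x (suc n) = begin
    fallλ lam x n * (x - fromℕ n * lam)
      ≈⟨ *-congʳ (fallλ-expansion lam x n) ⟩
    evalPoly n (fallCoeff lam n) x * (x - fromℕ n * lam)
      ≈⟨ sym (evalPoly-linear n (fallCoeff lam n) (fromℕ n * lam) x (fallCoeff-vanish lam n (suc n) ℕₚ.≤-refl)) ⟩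
    evalPoly (suc n) (fallCoeff lam (suc n)) x ∎

  -- Binomial convolution (w ⋆ a)(n) = Σ_{k ≤ n} C(n,k) a(k) w(n-k): the
  -- coefficientwise form of multiplying exponential generating functions.
  conv : (ℕ → Carrier) → (ℕ → Carrier) → ℕ → Carrier
  conv w a n = Σ≤ n (λ k → fromℕ (n C k) * a k * w (n ∸ k))

  -- Leibniz rule (differentiating a product of EGFs), from Pascal's rule.
  conv-leibniz : ∀ w a n →
    conv w a (suc n) ≈ conv w (λ k → a (suc k)) n + conv (λ j → w (suc j)) a n
  conv-leibniz w a n = begin
    Σ< (suc (suc n)) g                                    ≈⟨ Σ-front (suc n) g ⟩
    g 0 + Σ≤ n (λ i → g (suc i))                          ≈⟨ +-congˡ (Σ-cong′ (suc n) pascal) ⟩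
    g 0 + Σ≤ n (λ i → A i + h (suc i))                    ≈⟨ +-congˡ (Σ-+ (suc n) A _) ⟩
    g 0 + (Σ≤ n A + Σ≤ n (λ i → h (suc i)))
      ≈⟨ solve 3 (λ g A H → g :+ (A :+ H) := A :+ (g :+ H)) refl _ _ _ ⟩
    Σ≤ n A + (h 0 + Σ≤ n (λ i → h (suc i)))               ≈⟨ +-congˡ (sym (Σ-front (suc n) h)) ⟩
    Σ≤ n A + Σ≤ (suc n) h                                 ≈⟨ +-congˡ (trans (+-congˡ h-top) (+-identityʳ _)) ⟩
    Σ≤ n A + Σ≤ n h                                       ≈⟨ +-congˡ (Σ-cong (suc n) shift-kernel) ⟩
    conv w (λ k → a (suc k)) n + conv (λ j → w (suc j)) a n ∎
    where
    g h A : ℕ → Carrier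
    g k = fromℕ (suc n C k) * a k * w (suc n ∸ k)
    h k = fromℕ (n C k) * a k * w (suc n ∸ k)
    A k = fromℕ (n C k) * a (suc k) * w (n ∸ k)

    pascal : ∀ i → g (suc i) ≈ A i + h (suc i)
    pascal i = begin
      fromℕ (suc n C suc i) * a (suc i) * w (n ∸ i)
        ≈⟨ *-congʳ (*-congʳ (trans (reflexive (≡.cong fromℕ (≡.sym (nCk+nC[k+1]≡[n+1]C[k+1] n i)))) (fromℕ-+ (n C i) _))) ⟩
      (fromℕ (n C i) + fromℕ (n C suc i)) * a (suc i) * w (n ∸ i)
        ≈⟨ solve 4 (λ p q b v → (p :+ q) :* b :* v := p :* b :* v :+ q :* b :* v) refl _ _ _ _ ⟩
      A i + h (suc i) ∎

    h-top : h (suc n) ≈ 0#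
    h-top = trans (*-congʳ (trans (*-congʳ (reflexive (≡.cong fromℕ (k>n⇒nCk≡0 (ℕₚ.n<1+n n))))) (zeroˡ _))) (zeroˡ _)

    shift-kernel : ∀ k → k < suc n → h k ≈ fromℕ (n C k) * a k * w (suc (n ∸ k))
    shift-kernel k (s≤s k≤n) = *-congˡ (reflexive (≡.cong w (ℕₚ.+-∸-assoc 1 k≤n)))

  conv-+ˡ : ∀ w v a n → conv (λ j → w j + v j) a n ≈ conv w a n + conv v a n
  conv-+ˡ w v a n = trans (Σ-cong′ (suc n) (λ k → distribˡ _ _ _)) (Σ-+ (suc n) _ _)

  conv-+ʳ : ∀ w a b n → conv w (λ k → a k + b k) n ≈ conv w a n + conv w b n
  conv-+ʳ w a b n = trans
    (Σ-cong′ (suc n) (λ k → solve 4 (λ c p q v → c :* (p :+ q) :* v := c :* p :* v :+ c :* q :* v) refl _ _ _ _))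
    (Σ-+ (suc n) _ _)

  conv-*ʳ : ∀ w t a n → conv w (λ k → t * a k) n ≈ t * conv w a n
  conv-*ʳ w t a n = trans
    (Σ-cong′ (suc n) (λ k → solve 4 (λ c t p v → c :* (t :* p) :* v := t :* (c :* p :* v)) refl _ _ _ _))
    (sym (Σ-*ˡ (suc n) t _))

  conv-top : ∀ w a n → (∀ k → k < n → fromℕ (n C k) * a k * w (n ∸ k) ≈ 0#) →
    conv w a n ≈ a n * w 0
  conv-top w a n lower≈0 = begin
    Σ< n _ + fromℕ (n C n) * a n * w (n ∸ n) ≈⟨ +-congʳ (Σ-zero n _ lower≈0) ⟩
    0# + fromℕ (n C n) * a n * w (n ∸ n)     ≈⟨ +-identityˡ _ ⟩
    fromℕ (n C n) * a n * w (n ∸ n)          ≈⟨ *-cong (*-congʳ (reflexive (≡.cong fromℕ (nCn≡1 n)))) (reflexive (≡.cong w (ℕₚ.n∸n≡0 n))) ⟩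
    (1# + 0#) * a n * w 0                    ≈⟨ *-congʳ (trans (*-congʳ (+-identityʳ 1#)) (*-identityˡ _)) ⟩
    a n * w 0                                ∎

  δ0-positive : ∀ n k → k < n → δ0 (n ∸ k) ≈ 0#
  δ0-positive (suc n) zero _ = refl
  δ0-positive (suc n) (suc k) (s≤s k<n) = δ0-positive n k k<n

  conv-δ0 : ∀ a n → conv δ0 a n ≈ a n
  conv-δ0 a n = trans (conv-top δ0 a n (λ k k<n → trans (*-congˡ (δ0-positive n k k<n)) (zeroʳ _))) (*-identityʳ _)

  -- Convolution with a kernel whose constant term w(0) is invertible is
  -- injective: the equation at n determines a(n) from a(0), ..., a(n-1).
  conv-injective : ∀ u w a → u * w 0 ≈ 1# → (∀ n → conv w a n ≈ 0#) → ∀ n → a n ≈ 0#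
  conv-injective u w a inverse conv≈0 = <-rec _ step
    where
    step : ∀ n → (∀ {k} → k < n → a k ≈ 0#) → a n ≈ 0#
    step n ih = begin
      a n                ≈⟨ sym (*-identityʳ _) ⟩
      a n * 1#           ≈⟨ *-congˡ (sym inverse) ⟩
      a n * (u * w 0)    ≈⟨ solve 3 (λ a u w → a :* (u :* w) := u :* (a :* w)) refl _ _ _ ⟩
      u * (a n * w 0)    ≈⟨ *-congˡ (sym (conv-top w a n lower≈0)) ⟩
      u * conv w a n     ≈⟨ *-congˡ (conv≈0 n) ⟩
      u * 0#             ≈⟨ zeroʳ u ⟩
      0#                 ∎
      where
      lower≈0 : ∀ k → k < n → fromℕ (n C k) * a k * w (n ∸ k) ≈ 0#
      lower≈0 k k<n = trans (*-congʳ (trans (*-congˡ (ih k<n)) (zeroʳ _))) (zeroˡ _)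

  -- Degenerate Chu–Vandermonde identity: (1+λt)^{y/λ} (1+λt)^{x/λ} = (1+λt)^{(y+x)/λ}.
  vandermonde : ∀ lam x y n → conv (fallλ lam y) (fallλ lam x) n ≈ fallλ lam (y + x) n
  vandermonde lam x y zero = trans (+-identityˡ _) (trans (*-identityʳ _) (trans (*-identityʳ _) (+-identityʳ 1#)))
  vandermonde lam x y (suc n) = begin
    conv Y X (suc n)                                             ≈⟨ conv-leibniz Y X n ⟩
    conv Y (λ k → X (suc k)) n + conv (λ j → Y (suc j)) X n       ≈⟨ sym (Σ-+ (suc n) _ _) ⟩
    Σ≤ n (λ k → fromℕ (n C k) * X (suc k) * Y (n ∸ k) + fromℕ (n C k) * X k * Y (suc (n ∸ k)))
                                                                 ≈⟨ Σ-cong (suc n) step ⟩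
    Σ≤ n (λ k → z * T k)                                         ≈⟨ sym (Σ-*ˡ (suc n) z T) ⟩
    z * conv Y X n                                               ≈⟨ *-congˡ (vandermonde lam x y n) ⟩
    z * fallλ lam (y + x) n                                      ≈⟨ *-comm _ _ ⟩
    fallλ lam (y + x) (suc n)                                    ∎
    where
    X Y T : ℕ → Carrier
    X = fallλ lam x
    Y = fallλ lam y
    T k = fromℕ (n C k) * X k * Y (n ∸ k)
    z : Carrier
    z = (y + x) - fromℕ n * lam

    -- (x - kλ) + (y - (n-k)λ) = (y + x) - nλ
    step : ∀ k → k < suc n →
      fromℕ (n C k) * X (suc k) * Y (n ∸ k) + fromℕ (n C k) * X k * Y (suc (n ∸ k)) ≈ z * T k
    step k (s≤s k≤n) = begin
      fromℕ (n C k) * (X k * (x - fromℕ k * lam)) * Y (n ∸ k)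
        + fromℕ (n C k) * X k * (Y (n ∸ k) * (y - fromℕ (n ∸ k) * lam))
        ≈⟨ solve 8 (λ b X x i l Y y j → b :* (X :* (x :- i :* l)) :* Y :+ b :* X :* (Y :* (y :- j :* l))
                                        := ((y :+ x) :- (i :+ j) :* l) :* (b :* X :* Y)) refl _ _ _ _ _ _ _ _ ⟩
      ((y + x) - (fromℕ k + fromℕ (n ∸ k)) * lam) * T k
        ≈⟨ *-congʳ (+-congˡ (-‿cong (*-congʳ (trans (sym (fromℕ-+ k (n ∸ k))) (reflexive (≡.cong fromℕ (ℕₚ.m+[n∸m]≡n k≤n))))))) ⟩
      z * T k ∎

  -- The kernel of the defining relation: coefficients of (1+λt)^{1/λ} + 1, so
  -- that IsDegEuler lam E says  conv (eulerKernel lam) (E x) = 2 (x)_{·,λ}.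
  eulerKernel : Carrier → ℕ → Carrier
  eulerKernel lam j = fallλ lam 1# j + δ0 j

  conv-eulerKernel-fallλ : ∀ lam x n →
    conv (eulerKernel lam) (fallλ lam x) n ≈ fallλ lam (1# + x) n + fallλ lam x n
  conv-eulerKernel-fallλ lam x n =
    trans (conv-+ˡ (fallλ lam 1#) δ0 (fallλ lam x) n) (+-cong (vandermonde lam x 1# n) (conv-δ0 (fallλ lam x) n))

  -- Functional equation 𝓔_{n,λ}(x) + 𝓔_{n,λ}(x+1) = 2 (x)_{n,λ}: both sides
  -- satisfy the defining relation, whose kernel has invertible constant term 2.
  euler-functional-equation : ∀ half → half * two ≈ 1# → ∀ lam E → IsDegEuler lam E →
    ∀ x n → E x n + E (1# + x) n ≈ two * fallλ lam x n
  euler-functional-equation half half-inverse lam E isEuler x n =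
    x∙y⁻¹≈ε⇒x≈y _ _ (trans (solve 3 (λ p t q → p :- t :* q := p :+ (:- t) :* q) refl _ _ _)
                           (conv-injective half κ D half-inverse conv-D≈0 n))
    where
    κ : ℕ → Carrier
    κ = eulerKernel lam

    D : ℕ → Carrier
    D k = (E x k + E (1# + x) k) + (- two) * fallλ lam x k

    conv-D≈0 : ∀ n → conv κ D n ≈ 0#
    conv-D≈0 n = begin
      conv κ D n
        ≈⟨ trans (conv-+ʳ κ _ _ n) (+-cong (conv-+ʳ κ (E x) (E (1# + x)) n) (conv-*ʳ κ (- two) (fallλ lam x) n)) ⟩
      (conv κ (E x) n + conv κ (E (1# + x)) n) + (- two) * conv κ (fallλ lam x) n
        ≈⟨ +-cong (+-cong (isEuler x n) (isEuler (1# + x) n)) (*-congˡ (conv-eulerKernel-fallλ lam x n)) ⟩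
      (two * fallλ lam x n + two * fallλ lam (1# + x) n) + (- two) * (fallλ lam (1# + x) n + fallλ lam x n)
        ≈⟨ solve 3 (λ t f g → (t :* f :+ t :* g) :+ (:- t) :* (g :+ f) := (t :- t) :* f) refl _ _ _ ⟩
      (two - two) * fallλ lam x n
        ≈⟨ trans (*-congʳ (-‿inverseʳ two)) (zeroˡ _) ⟩
      0# ∎

  alternating-telescope : ∀ (Q : ℕ → Carrier) m →
    Σ< m (λ l → pow (- 1#) l * (Q l + Q (suc l))) ≈ Q 0 - pow (- 1#) m * Q m
  alternating-telescope Q zero = sym (trans (+-congˡ (-‿cong (*-identityˡ _))) (-‿inverseʳ _))
  alternating-telescope Q (suc m) = begin
    Σ< m (λ l → pow (- 1#) l * (Q l + Q (suc l))) + pow (- 1#) m * (Q m + Q (suc m))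
      ≈⟨ +-congʳ (alternating-telescope Q m) ⟩
    (Q 0 - pow (- 1#) m * Q m) + pow (- 1#) m * (Q m + Q (suc m))
      ≈⟨ solve 4 (λ q₀ s q q′ → (q₀ :- s :* q) :+ s :* (q :+ q′) := q₀ :- (:- s) :* q′) refl _ _ _ _ ⟩
    Q 0 - (- pow (- 1#) m) * Q (suc m)
      ≈⟨ +-congˡ (-‿cong (*-congʳ (sym (-1*x≈-x _)))) ⟩
    Q 0 - pow (- 1#) (suc m) * Q (suc m) ∎

  pow-minus-one-odd : ∀ m → m % 2 ≡ 1 → pow (- 1#) m ≈ - 1#
  pow-minus-one-odd m m-odd = ≡.subst (λ j → pow (- 1#) j ≈ - 1#) (≡.sym m≡2q+1) (odd (m / 2))
    where
    m≡2q+1 : m ≡ suc ((m / 2) ℕ.* 2)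
    m≡2q+1 = ≡.trans (m≡m%n+[m/n]*n m 2) (≡.cong (ℕ._+ (m / 2) ℕ.* 2) m-odd)

    odd : ∀ q → pow (- 1#) (suc (q ℕ.* 2)) ≈ - 1#
    odd zero = *-identityʳ _
    odd (suc q) = trans (-1*x≈-x _) (trans (-‿cong (-1*x≈-x _)) (trans (⁻¹-involutive _) (odd q)))

  alternating-odd : ∀ (Q : ℕ → Carrier) m → m % 2 ≡ 1 →
    Q 0 + Q m ≈ Σ< m (λ l → pow (- 1#) l * (Q l + Q (suc l)))
  alternating-odd Q m m-odd = begin
    Q 0 + Q m                    ≈⟨ +-congˡ (sym (⁻¹-involutive _)) ⟩
    Q 0 - (- Q m)                ≈⟨ +-congˡ (-‿cong (sym (-1*x≈-x _))) ⟩
    Q 0 - (- 1# * Q m)           ≈⟨ +-congˡ (-‿cong (*-congʳ (sym (pow-minus-one-odd m m-odd)))) ⟩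
    Q 0 - pow (- 1#) m * Q m     ≈⟨ sym (alternating-telescope Q m) ⟩
    Σ< m (λ l → pow (- 1#) l * (Q l + Q (suc l))) ∎

theorem1 : ∀ {c ℓ} (R : CommutativeRing c ℓ) →
    let open CommutativeRing R
        open Degenerate R
    in (half : Carrier) → half * (1# + 1#) ≈ 1# →
       (lam : Carrier) → ¬ (lam ≈ 0#) →
       (E : Carrier → ℕ → Carrier) → IsDegEuler lam E →
       (n m : ℕ) → m % 2 ≡ 1 →
       E 0# n + E (fromℕ m) n
         ≈ (1# + 1#) * Σ≤ n (λ k → Σ< m (λ l →
              pow (- 1#) l * S1λ lam n k * pow (fromℕ l) k))
theorem1 R half half-inverse lam _ E isEuler n m m-odd = begin
  E 0# n + E (fromℕ m) n
    ≈⟨ alternating-odd (λ l → E (fromℕ l) n) m m-odd ⟩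
  Σ< m (λ l → pow (- 1#) l * (E (fromℕ l) n + E (1# + fromℕ l) n))
    ≈⟨ Σ-cong′ m (λ l → *-congˡ (euler-at l)) ⟩
  Σ< m (λ l → pow (- 1#) l * (two * evalPoly n (S1λ lam n) (fromℕ l)))
    ≈⟨ Σ-factor-swap m (suc n) two (pow (- 1#)) (S1λ lam n) (λ l k → pow (fromℕ l) k) ⟩
  two * Σ≤ n (λ k → Σ< m (λ l → pow (- 1#) l * S1λ lam n k * pow (fromℕ l) k)) ∎
  where
  open CommutativeRing R
  open Degenerate R
  open DegenerateEulerTheory R
  open import Relation.Binary.Reasoning.Setoid setoid

  euler-at : ∀ l → E (fromℕ l) n + E (1# + fromℕ l) n ≈ two * evalPoly n (S1λ lam n) (fromℕ l)
  euler-at l = trans (euler-functional-equation half half-inverse lam E isEuler (fromℕ l) n)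
                     (*-congˡ (fallλ-expansion lam (fromℕ l) n))
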